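{- Let $H$ be a connected triangle-free multigraph and let $G=L(H)$. If $G$ is CIS, then $|V(G)|\le \alpha(G)\cdot\omega(G)$.
   Context: Graphs are finite; multigraphs may have parallel edges (loops may be assumed absent). The line graph $L(H)$ of a multigraph $H$ is the simple graph with vertex set $E(H)$ in which two distinct edges are adjacent iff they have a common endpoint. A multigraph is triangle-free if it has no three pairwise adjacent vertices. A graph is CIS if every inclusion-maximal clique intersects every inclusion-maximal stable set. $\alpha(G)$ and $\omega(G)$ are the maximum sizes of a stable set and of a clique in $G$. -}

module Defs where

open import Data.Nat using (ℕ; _≤_)
open import Data.Fin using (Fin)
open import Data.Fin.Subset using (Subset; _∈_; _⊆_; ∣_∣)
open import Data.Product using (_×_; Σ; ∃; proj₁; proj₂)
open import Data.Sum using (_⊎_)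
open import Data.Empty using (⊥)
open import Relation.Binary.PropositionalEquality using (_≡_; _≢_)

record Multigraph : Set where
  field
    n     : ℕ
    m     : ℕ
    ends  : Fin m → Fin n × Fin n
    noLoop : ∀ e → proj₁ (ends e) ≢ proj₂ (ends e)

module _ (H : Multigraph) where
  open Multigraph H

  Incident : Fin n → Fin m → Set
  Incident v e = v ≡ proj₁ (ends e) ⊎ v ≡ proj₂ (ends e)

  MAdj : Fin n → Fin n → Set
  MAdj u v = ∃ λ e → (u ≡ proj₁ (ends e) × v ≡ proj₂ (ends e))
                   ⊎ (u ≡ proj₂ (ends e) × v ≡ proj₁ (ends e))

  data Reach : Fin n → Fin n → Set where
    here : ∀ {u} → Reach u u
    step : ∀ {u w v} → MAdj u w → Reach w v → Reach u v

  Connected : Set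
  Connected = ∀ u v → Reach u v

  TriangleFree : Set
  TriangleFree = ∀ x y z → MAdj x y → MAdj y z → MAdj x z → ⊥

  LineAdj : Fin m → Fin m → Set
  LineAdj e f = e ≢ f × ∃ λ v → Incident v e × Incident v f

module _ {k : ℕ} (Adj : Fin k → Fin k → Set) where

  IsClique : Subset k → Set
  IsClique S = ∀ x y → x ∈ S → y ∈ S → x ≢ y → Adj x y

  IsStable : Subset k → Set
  IsStable S = ∀ x y → x ∈ S → y ∈ S → Adj x y → ⊥

  IsMaximalClique : Subset k → Set
  IsMaximalClique S = IsClique S × (∀ T → IsClique T → S ⊆ T → T ⊆ S)

  IsMaximalStable : Subset k → Set
  IsMaximalStable S = IsStable S × (∀ T → IsStable T → S ⊆ T → T ⊆ S)

  IsCIS : Set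
  IsCIS = ∀ C S → IsMaximalClique C → IsMaximalStable S → ∃ λ x → x ∈ C × x ∈ S

  IsStabilityNumber : ℕ → Set
  IsStabilityNumber a = (∃ λ S → IsStable S × ∣ S ∣ ≡ a) × (∀ S → IsStable S → ∣ S ∣ ≤ a)

  IsCliqueNumber : ℕ → Set
  IsCliqueNumber w = (∃ λ S → IsClique S × ∣ S ∣ ≡ w) × (∀ S → IsClique S → ∣ S ∣ ≤ w)

-- Let M be a maximum matching of H, i.e. a maximum stable set of L(H), so |M| = α.  Stars are
-- cliques of L(H), hence every degree is at most ω.  Charge each end x of an edge xy to the
-- matching edge covering x, or to the one covering y if x is uncovered (maximality of M rules
-- out both ends being uncovered); this makes 2|E(H)| charges.  A matching edge s = uv receives
-- at most 2ω of them.  If neither u nor v has an uncovered neighbour, all its charges come from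
-- ends at u or v, at most deg u + deg v.  If u has an uncovered neighbour z via an edge e, then
-- M - s + e is again a maximum stable set, and it misses the star of v; by CIS that star is not
-- a maximal clique, which in a triangle-free graph forces every edge at v to run to u.  Then
-- every edge charging s contains u, giving at most 2 deg u.  Hence 2|E(H)| ≤ 2αω.

module Submission where

open import Level using (Level)
open import Function using (_∘_)
open import Data.Bool using (if_then_else_; true; false)
open import Data.Empty using (⊥)
open import Data.Nat using (ℕ; zero; suc; _+_; _*_; _≤_; z≤n; s≤s)
open import Data.Nat.Properties
  using (≤-refl; n≤1+n; n≤0⇒n≡0; ≤-trans; ≤-antisym; ≤-reflexive; <⇒≱; +-mono-≤;
         +-identityʳ; *-cancelʳ-≤; +-*-semiring; +-commutativeSemigroup; module ≤-Reasoning)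
open import Data.Nat.Tactic.RingSolver using (solve-∀)
open import Algebra.Properties.Semiring.Sum +-*-semiring
  using (sum; sum-cong-≗; sum-replicate-zero; ∑-distrib-+; ∑-comm; *-distribʳ-sum)
open import Algebra.Properties.CommutativeSemigroup +-commutativeSemigroup using (interchange)
open import Data.Fin using (Fin; zero; suc; _≟_)
open import Data.Fin.Properties using (any?)
open import Data.Fin.Subset
  using (Subset; _∈_; _∉_; _⊆_; ∣_∣; _∪_; _-_; ⁅_⁆; inside; outside)
open import Data.Fin.Subset.Properties
  using (_∈?_; p⊂q⇒∣p∣<∣q∣; p⊆p∪q; q⊆p∪q; x∈p∪q⁻; x∈⁅x⁆; x∈⁅y⁆⇒x≡y;
         p─q⊆p; p─⊥≡p; ∪-identityʳ)
open import Data.Vec using ([]; _∷_; lookup; tabulate; here; there)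
open import Data.Vec.Properties using (lookup∘tabulate; []=⇒lookup; lookup⇒[]=)
open import Data.Product using (∃; _×_; _,_; proj₁; proj₂)
open import Data.Sum as Sum using (_⊎_; inj₁; inj₂)
open import Relation.Nullary using (Dec; yes; no; does; ¬_; ¬?; _×-dec_; _⊎-dec_; contradiction)
open import Relation.Nullary.Decidable using (dec-true; dec-false; decidable-stable; map′)
open import Relation.Unary using (Pred; Decidable)
open import Relation.Binary.Definitions using (Symmetric)
open import Relation.Binary.PropositionalEquality
  using (_≡_; _≢_; refl; sym; trans; cong; cong₂; subst; module ≡-Reasoning)

open import Defs

private
  variable
    ℓ ℓ′ : Level
    A B : Set ℓ
    k : ℕ

𝟙 : Dec A → ℕ
𝟙 a? = if does a? then 1 else 0

𝟙-mono : (a? : Dec A) (b? : Dec B) → (A → B) → 𝟙 a? ≤ 𝟙 b?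
𝟙-mono (no _)  _        _   = z≤n
𝟙-mono (yes _) (yes _)  _   = ≤-refl
𝟙-mono (yes a) (no ¬b)  a→b = contradiction (a→b a) ¬b

𝟙-cong : (a? : Dec A) (b? : Dec B) → (A → B) → (B → A) → 𝟙 a? ≡ 𝟙 b?
𝟙-cong a? b? a→b b→a = ≤-antisym (𝟙-mono a? b? a→b) (𝟙-mono b? a? b→a)

𝟙-⊎-≤ : (a? : Dec A) (b? : Dec B) → 𝟙 (a? ⊎-dec b?) ≤ 𝟙 a? + 𝟙 b?
𝟙-⊎-≤ (yes _) (yes _) = s≤s z≤n
𝟙-⊎-≤ (yes _) (no _)  = ≤-refl
𝟙-⊎-≤ (no _)  (yes _) = ≤-refl
𝟙-⊎-≤ (no _)  (no _)  = ≤-refl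

𝟙-⊎ : (a? : Dec A) (b? : Dec B) → ¬ (A × B) → 𝟙 (a? ⊎-dec b?) ≡ 𝟙 a? + 𝟙 b?
𝟙-⊎ (yes a) (yes b) ¬ab = contradiction (a , b) ¬ab
𝟙-⊎ (yes _) (no _)  _   = refl
𝟙-⊎ (no _)  (yes _) _   = refl
𝟙-⊎ (no _)  (no _)  _   = refl

sum-mono-≤ : {f g : Fin k → ℕ} → (∀ i → f i ≤ g i) → sum f ≤ sum g
sum-mono-≤ {zero}  f≤g = z≤n
sum-mono-≤ {suc k} f≤g = +-mono-≤ (f≤g zero) (sum-mono-≤ (f≤g ∘ suc))

sum-const : ∀ k c → sum {k} (λ _ → c) ≡ k * c
sum-const zero    c = refl
sum-const (suc k) c = cong (c +_) (sum-const k c)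

sum-𝟙-≟ : (t : Fin k) → sum (λ s → 𝟙 (t ≟ s)) ≡ 1
sum-𝟙-≟ {suc k} zero    = cong suc (sum-replicate-zero k)
sum-𝟙-≟ {suc k} (suc t) = sum-𝟙-≟ t

∣p∣≡sum-𝟙-∈ : (p : Subset k) → ∣ p ∣ ≡ sum (λ i → 𝟙 (i ∈? p))
∣p∣≡sum-𝟙-∈ []            = refl
∣p∣≡sum-𝟙-∈ (inside  ∷ p) = cong suc (∣p∣≡sum-𝟙-∈ p)
∣p∣≡sum-𝟙-∈ (outside ∷ p) = ∣p∣≡sum-𝟙-∈ p

x∉p-x : (p : Subset k) (x : Fin k) → x ∉ p - x
x∉p-x (inside  ∷ p) zero    ()
x∉p-x (outside ∷ p) zero    ()
x∉p-x (_       ∷ p) (suc x) (there x∈p-x) = x∉p-x p x x∈p-x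

x∈p-y⇒x≢y : {p : Subset k} {x y : Fin k} → x ∈ p - y → x ≢ y
x∈p-y⇒x≢y {p = p} {x} x∈p-x refl = x∉p-x p x x∈p-x

∣p∣≤1+∣p-x∣ : (p : Subset k) (x : Fin k) → ∣ p ∣ ≤ suc ∣ p - x ∣
∣p∣≤1+∣p-x∣ (inside  ∷ p) zero    = s≤s (≤-reflexive (cong ∣_∣ (sym (p─⊥≡p p))))
∣p∣≤1+∣p-x∣ (outside ∷ p) zero    =
  ≤-trans (≤-reflexive (cong ∣_∣ (sym (p─⊥≡p p)))) (n≤1+n _)
∣p∣≤1+∣p-x∣ (inside  ∷ p) (suc x) = s≤s (∣p∣≤1+∣p-x∣ p x)
∣p∣≤1+∣p-x∣ (outside ∷ p) (suc x) = ∣p∣≤1+∣p-x∣ p x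

x∉p⇒∣p∪⁅x⁆∣≡1+∣p∣ : {p : Subset k} {x : Fin k} →
                     x ∉ p → ∣ p ∪ ⁅ x ⁆ ∣ ≡ suc ∣ p ∣
x∉p⇒∣p∪⁅x⁆∣≡1+∣p∣ {p = inside  ∷ p} {zero}  x∉p = contradiction here x∉p
x∉p⇒∣p∪⁅x⁆∣≡1+∣p∣ {p = outside ∷ p} {zero}  _   = cong (suc ∘ ∣_∣) (∪-identityʳ p)
x∉p⇒∣p∪⁅x⁆∣≡1+∣p∣ {p = inside  ∷ p} {suc x} x∉p =
  cong suc (x∉p⇒∣p∪⁅x⁆∣≡1+∣p∣ (x∉p ∘ there))
x∉p⇒∣p∪⁅x⁆∣≡1+∣p∣ {p = outside ∷ p} {suc x} x∉p =
  x∉p⇒∣p∪⁅x⁆∣≡1+∣p∣ (x∉p ∘ there)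

⟦_⟧ : {P : Pred (Fin k) ℓ′} → Decidable P → Subset k
⟦ P? ⟧ = tabulate (does ∘ P?)

module _ {P : Pred (Fin k) ℓ′} (P? : Decidable P) where

  ∈⟦⟧⁺ : ∀ {i} → P i → i ∈ ⟦ P? ⟧
  ∈⟦⟧⁺ {i} Pi =
    lookup⇒[]= i ⟦ P? ⟧ (trans (lookup∘tabulate (does ∘ P?) i) (dec-true (P? i) Pi))

  ∈⟦⟧⁻ : ∀ {i} → i ∈ ⟦ P? ⟧ → P i
  ∈⟦⟧⁻ {i} i∈ = decidable-stable (P? i) λ ¬Pi → true≢false (begin
    true                    ≡⟨ []=⇒lookup i∈ ⟨
    lookup ⟦ P? ⟧ i         ≡⟨ lookup∘tabulate (does ∘ P?) i ⟩
    does (P? i)             ≡⟨ dec-false (P? i) ¬Pi ⟩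
    false                   ∎)
    where
    open ≡-Reasoning
    true≢false : true ≢ false
    true≢false ()

  ∣⟦⟧∣ : ∣ ⟦ P? ⟧ ∣ ≡ sum (𝟙 ∘ P?)
  ∣⟦⟧∣ = trans (∣p∣≡sum-𝟙-∈ ⟦ P? ⟧)
               (sum-cong-≗ λ i → 𝟙-cong (i ∈? ⟦ P? ⟧) (P? i) ∈⟦⟧⁻ ∈⟦⟧⁺)

module _ {Adj : Fin k → Fin k → Set} where

  IsMaximumStable : Subset k → Set
  IsMaximumStable S = IsStable Adj S × (∀ T → IsStable Adj T → ∣ T ∣ ≤ ∣ S ∣)

  maximum⇒maximal : ∀ {S} → IsMaximumStable S → IsMaximalStable Adj S
  maximum⇒maximal {S} (S-stable , S-maximum) = S-stable , grow
    where
    grow : ∀ T → IsStable Adj T → S ⊆ T → T ⊆ S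
    grow T T-stable S⊆T {x} x∈T = decidable-stable (x ∈? S) λ x∉S →
      <⇒≱ (p⊂q⇒∣p∣<∣q∣ (S⊆T , x , x∈T , x∉S)) (S-maximum T T-stable)

  stable-∪⁅⁆ : ∀ {S e} → Symmetric Adj → ¬ Adj e e →
               (∀ f → f ∈ S → ¬ Adj e f) → IsStable Adj S → IsStable Adj (S ∪ ⁅ e ⁆)
  stable-∪⁅⁆ {S} {e} sym-Adj irrefl indep S-stable x y x∈ y∈
    with x∈p∪q⁻ S ⁅ e ⁆ x∈ | x∈p∪q⁻ S ⁅ e ⁆ y∈
  ... | inj₁ x∈S | inj₁ y∈S = S-stable x y x∈S y∈S
  ... | inj₂ x∈e | inj₁ y∈S rewrite x∈⁅y⁆⇒x≡y e x∈e = indep y y∈S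
  ... | inj₁ x∈S | inj₂ y∈e rewrite x∈⁅y⁆⇒x≡y e y∈e = indep x x∈S ∘ sym-Adj
  ... | inj₂ x∈e | inj₂ y∈e
    rewrite x∈⁅y⁆⇒x≡y e x∈e | x∈⁅y⁆⇒x≡y e y∈e = irrefl

module _ (H : Multigraph) where
  open Multigraph H

  end₁ end₂ : Fin m → Fin n
  end₁ e = proj₁ (ends e)
  end₂ e = proj₂ (ends e)

  Joins : Fin m → Fin n → Fin n → Set
  Joins e x y = (x ≡ end₁ e × y ≡ end₂ e) ⊎ (x ≡ end₂ e × y ≡ end₁ e)

  private
    variable
      e f g s : Fin m
      t u v x y z : Fin n

  joins-ends : ∀ e → Joins e (end₁ e) (end₂ e)
  joins-ends e = inj₁ (refl , refl)

  joins-sym : Joins e x y → Joins e y x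
  joins-sym (inj₁ (x≡ , y≡)) = inj₂ (y≡ , x≡)
  joins-sym (inj₂ (x≡ , y≡)) = inj₁ (y≡ , x≡)

  joins⇒incident : Joins e x y → Incident H x e
  joins⇒incident (inj₁ (x≡ , _)) = inj₁ x≡
  joins⇒incident (inj₂ (x≡ , _)) = inj₂ x≡

  joins⇒≢ : Joins e x y → x ≢ y
  joins⇒≢ {e} (inj₁ (refl , refl)) = noLoop e
  joins⇒≢ {e} (inj₂ (refl , refl)) = noLoop e ∘ sym

  incident⇒joins : Incident H x e → ∃ λ y → Joins e x y
  incident⇒joins {e = e} (inj₁ x≡) = end₂ e , inj₁ (x≡ , refl)
  incident⇒joins {e = e} (inj₂ x≡) = end₁ e , inj₂ (x≡ , refl)

  incident⇒endpoint : Joins e x y → Incident H z e → z ≡ x ⊎ z ≡ y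
  incident⇒endpoint (inj₁ (refl , refl)) z∈e        = z∈e
  incident⇒endpoint (inj₂ (refl , refl)) (inj₁ z≡) = inj₂ z≡
  incident⇒endpoint (inj₂ (refl , refl)) (inj₂ z≡) = inj₁ z≡

  incident²⇒joins : Incident H x e → Incident H y e → x ≢ y → Joins e x y
  incident²⇒joins (inj₁ x≡) (inj₁ y≡) x≢y = contradiction (trans x≡ (sym y≡)) x≢y
  incident²⇒joins (inj₁ x≡) (inj₂ y≡) _   = inj₁ (x≡ , y≡)
  incident²⇒joins (inj₂ x≡) (inj₁ y≡) _   = inj₂ (x≡ , y≡)
  incident²⇒joins (inj₂ x≡) (inj₂ y≡) x≢y = contradiction (trans x≡ (sym y≡)) x≢y

  Incident? : ∀ v e → Dec (Incident H v e)
  Incident? v e = (v ≟ end₁ e) ⊎-dec (v ≟ end₂ e)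

  lineAdj-sym : Symmetric (LineAdj H)
  lineAdj-sym (e≢f , v , v∈e , v∈f) = e≢f ∘ sym , v , v∈f , v∈e

  lineAdj-irrefl : ¬ LineAdj H e e
  lineAdj-irrefl (e≢e , _) = e≢e refl

  lineAdj-other-end : Joins g v u → ¬ Incident H v f → LineAdj H f g → Incident H u f
  lineAdj-other-end g-vu v∉f (_ , z , z∈f , z∈g) with incident⇒endpoint g-vu z∈g
  ... | inj₁ refl = contradiction z∈f v∉f
  ... | inj₂ refl = z∈f

  star : Fin n → Subset m
  star v = ⟦ Incident? v ⟧

  degree : Fin n → ℕ
  degree v = sum (𝟙 ∘ Incident? v)

  star-isClique : ∀ v → IsClique (LineAdj H) (star v)
  star-isClique v e f e∈ f∈ e≢f =
    e≢f , v , ∈⟦⟧⁻ (Incident? v) e∈ , ∈⟦⟧⁻ (Incident? v) f∈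

  star-isMaximalClique : TriangleFree H → Joins g v u → Joins f v t → u ≢ t →
                         IsMaximalClique (LineAdj H) (star v)
  star-isMaximalClique {g} {v} {u} {f} {t} tf g-vu f-vt u≢t = star-isClique v , grow
    where
    grow : ∀ T → IsClique (LineAdj H) T → star v ⊆ T → T ⊆ star v
    grow T T-clique star⊆T {h} h∈T =
      ∈⟦⟧⁺ (Incident? v) (decidable-stable (Incident? v h) λ v∉h →
        tf v u t (g , g-vu) (h , incident²⇒joins (meets g-vu v∉h) (meets f-vt v∉h) u≢t) (f , f-vt))
      where
      meets : ∀ {g w} → Joins g v w → ¬ Incident H v h → Incident H w h
      meets {g} g-vw v∉h = lineAdj-other-end g-vw v∉h
        (T-clique h g h∈T (star⊆T (∈⟦⟧⁺ (Incident? v) v∈g)) λ { refl → v∉h v∈g })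
        where
        v∈g : Incident H v g
        v∈g = joins⇒incident g-vw

  module _ {M : Subset m} (M-maximum : IsMaximumStable {Adj = LineAdj H} M) where

    private
      M-stable : IsStable (LineAdj H) M
      M-stable = proj₁ M-maximum

    Covered : Fin n → Set
    Covered v = ∃ λ s → s ∈ M × Incident H v s

    covered? : ∀ v → Dec (Covered v)
    covered? v = any? λ s → (s ∈? M) ×-dec Incident? v s

    AdjacentToUncovered : Fin n → Set
    AdjacentToUncovered u = ∃ λ e → ∃ λ z → Joins e u z × ¬ Covered z

    adjacentToUncovered? : ∀ u → Dec (AdjacentToUncovered u)
    adjacentToUncovered? u = map′ from to (any? λ e →
        ((u ≟ end₁ e) ×-dec ¬? (covered? (end₂ e))) ⊎-dec
        ((u ≟ end₂ e) ×-dec ¬? (covered? (end₁ e))))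
      where
      Witness : Fin m → Set
      Witness e = (u ≡ end₁ e × ¬ Covered (end₂ e)) ⊎ (u ≡ end₂ e × ¬ Covered (end₁ e))

      from : ∃ Witness → AdjacentToUncovered u
      from (e , inj₁ (u≡ , ¬c)) = e , end₂ e , inj₁ (u≡ , refl) , ¬c
      from (e , inj₂ (u≡ , ¬c)) = e , end₁ e , inj₂ (u≡ , refl) , ¬c

      to : AdjacentToUncovered u → ∃ Witness
      to (e , _ , inj₁ (u≡ , refl) , ¬c) = e , inj₁ (u≡ , ¬c)
      to (e , _ , inj₂ (u≡ , refl) , ¬c) = e , inj₂ (u≡ , ¬c)

    covered-end : Joins e x y → ¬ Covered x → Covered y
    covered-end {e} {x} {y} e-xy ¬cx = decidable-stable (covered? y) λ ¬cy →
      let e∈M = proj₂ (maximum⇒maximal M-maximum) (M ∪ ⁅ e ⁆)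
                  (stable-∪⁅⁆ lineAdj-sym lineAdj-irrefl (independent ¬cy) M-stable)
                  (p⊆p∪q ⁅ e ⁆) (q⊆p∪q M ⁅ e ⁆ (x∈⁅x⁆ e))
      in ¬cx (e , e∈M , joins⇒incident e-xy)
      where
      independent : ¬ Covered y → ∀ f → f ∈ M → ¬ LineAdj H e f
      independent ¬cy f f∈M (_ , w , w∈e , w∈f) with incident⇒endpoint e-xy w∈e
      ... | inj₁ refl = ¬cx (f , f∈M , w∈f)
      ... | inj₂ refl = ¬cy (f , f∈M , w∈f)

    exchange-isMaximumStable : s ∈ M → Incident H u s → Joins e u z → ¬ Covered z →
                               IsMaximumStable {Adj = LineAdj H} ((M - s) ∪ ⁅ e ⁆)
    exchange-isMaximumStable {s} {u} {e} {z} s∈M u∈s e-uz ¬cz =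
      stable-∪⁅⁆ lineAdj-sym lineAdj-irrefl independent M-s-stable ,
      λ T T-stable → ≤-trans (proj₂ M-maximum T T-stable) ∣M∣≤∣M′∣
      where
      M-s⊆M : M - s ⊆ M
      M-s⊆M = p─q⊆p M ⁅ s ⁆

      M-s-stable : IsStable (LineAdj H) (M - s)
      M-s-stable x y x∈ y∈ = M-stable x y (M-s⊆M x∈) (M-s⊆M y∈)

      independent : ∀ f → f ∈ M - s → ¬ LineAdj H e f
      independent f f∈M-s (_ , w , w∈e , w∈f) with incident⇒endpoint e-uz w∈e
      ... | inj₁ refl = M-stable f s (M-s⊆M f∈M-s) s∈M (x∈p-y⇒x≢y f∈M-s , w , w∈f , u∈s)
      ... | inj₂ refl = ¬cz (f , M-s⊆M f∈M-s , w∈f)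

      e∉M-s : e ∉ M - s
      e∉M-s e∈M-s = ¬cz (e , M-s⊆M e∈M-s , joins⇒incident (joins-sym e-uz))

      ∣M∣≤∣M′∣ : ∣ M ∣ ≤ ∣ (M - s) ∪ ⁅ e ⁆ ∣
      ∣M∣≤∣M′∣ = begin
        ∣ M ∣                   ≤⟨ ∣p∣≤1+∣p-x∣ M s ⟩
        suc ∣ M - s ∣           ≡⟨ x∉p⇒∣p∪⁅x⁆∣≡1+∣p∣ e∉M-s ⟨
        ∣ (M - s) ∪ ⁅ e ⁆ ∣     ∎
        where open ≤-Reasoning

    -- The last clause is a junk value: by covered-end it never applies when e joins x and y.
    charge : Fin m → Fin n → Fin n → Fin m
    charge e x y with covered? x | covered? y
    ... | yes (s , _) | _           = s
    ... | no _        | yes (s , _) = s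
    ... | no _        | no _        = e

    charge-∈ : Joins e x y → charge e x y ∈ M
    charge-∈ {e} {x} {y} e-xy with covered? x | covered? y
    ... | yes (_ , s∈M , _) | _                 = s∈M
    ... | no _              | yes (_ , s∈M , _) = s∈M
    ... | no ¬cx            | no ¬cy            = contradiction (covered-end e-xy ¬cx) ¬cy

    charge-incident : Joins e x y →
                      Incident H x (charge e x y) ⊎ (¬ Covered x × Incident H y (charge e x y))
    charge-incident {e} {x} {y} e-xy with covered? x | covered? y
    ... | yes (_ , _ , x∈s) | _                 = inj₁ x∈s
    ... | no ¬cx            | yes (_ , _ , y∈s) = inj₂ (¬cx , y∈s)
    ... | no ¬cx            | no ¬cy            = contradiction (covered-end e-xy ¬cx) ¬cy

    weight : Fin m → Fin m → ℕ
    weight e s = 𝟙 (charge e (end₁ e) (end₂ e) ≟ s) + 𝟙 (charge e (end₂ e) (end₁ e) ≟ s)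

    weight-total : ∀ e → sum (weight e) ≡ 2
    weight-total e = begin
      sum (weight e)
        ≡⟨ ∑-distrib-+ (λ s → 𝟙 (c₁ ≟ s)) (λ s → 𝟙 (c₂ ≟ s)) ⟩
      sum (λ s → 𝟙 (c₁ ≟ s)) + sum (λ s → 𝟙 (c₂ ≟ s))
        ≡⟨ cong₂ _+_ (sum-𝟙-≟ c₁) (sum-𝟙-≟ c₂) ⟩
      2 ∎
      where
      open ≡-Reasoning
      c₁ c₂ : Fin m
      c₁ = charge e (end₁ e) (end₂ e)
      c₂ = charge e (end₂ e) (end₁ e)

    load : Fin m → ℕ
    load s = sum (λ e → weight e s)

    weight-≤-𝟙u+𝟙u : (∀ {e x y} → Joins e x y → charge e x y ≡ s → Incident H u e) →
                     ∀ e → weight e s ≤ 𝟙 (Incident? u e) + 𝟙 (Incident? u e)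
    weight-≤-𝟙u+𝟙u {s} {u} charged⇒u∈ e =
      +-mono-≤ (𝟙-mono (charge e x₁ x₂ ≟ s) (Incident? u e) (charged⇒u∈ e-x₁x₂))
               (𝟙-mono (charge e x₂ x₁ ≟ s) (Incident? u e) (charged⇒u∈ (joins-sym e-x₁x₂)))
      where
      x₁ x₂ : Fin n
      x₁ = end₁ e
      x₂ = end₂ e

      e-x₁x₂ : Joins e x₁ x₂
      e-x₁x₂ = joins-ends e

    weight-≤-𝟙u+𝟙v : (∀ {e x y} → Joins e x y → charge e x y ≡ s → u ≡ x ⊎ v ≡ x) →
                     ∀ e → weight e s ≤ 𝟙 (Incident? u e) + 𝟙 (Incident? v e)
    weight-≤-𝟙u+𝟙v {s} {u} {v} charged⇒end e = begin
      weight e s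
        ≤⟨ +-mono-≤ (𝟙-mono (charge e x₁ x₂ ≟ s) (u≟∨v≟ x₁) (charged⇒end e-x₁x₂))
                    (𝟙-mono (charge e x₂ x₁ ≟ s) (u≟∨v≟ x₂) (charged⇒end (joins-sym e-x₁x₂))) ⟩
      𝟙 (u≟∨v≟ x₁) + 𝟙 (u≟∨v≟ x₂)
        ≤⟨ +-mono-≤ (𝟙-⊎-≤ (u ≟ x₁) (v ≟ x₁)) (𝟙-⊎-≤ (u ≟ x₂) (v ≟ x₂)) ⟩
      (𝟙 (u ≟ x₁) + 𝟙 (v ≟ x₁)) + (𝟙 (u ≟ x₂) + 𝟙 (v ≟ x₂))
        ≡⟨ interchange (𝟙 (u ≟ x₁)) (𝟙 (v ≟ x₁)) (𝟙 (u ≟ x₂)) (𝟙 (v ≟ x₂)) ⟩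
      (𝟙 (u ≟ x₁) + 𝟙 (u ≟ x₂)) + (𝟙 (v ≟ x₁) + 𝟙 (v ≟ x₂))
        ≡⟨ cong₂ _+_ (𝟙-⊎ (u ≟ x₁) (u ≟ x₂) not-both)
                     (𝟙-⊎ (v ≟ x₁) (v ≟ x₂) not-both) ⟨
      𝟙 (Incident? u e) + 𝟙 (Incident? v e)
        ∎
      where
      open ≤-Reasoning
      x₁ x₂ : Fin n
      x₁ = end₁ e
      x₂ = end₂ e

      e-x₁x₂ : Joins e x₁ x₂
      e-x₁x₂ = joins-ends e

      u≟∨v≟ : ∀ x → Dec (u ≡ x ⊎ v ≡ x)
      u≟∨v≟ x = (u ≟ x) ⊎-dec (v ≟ x)

      not-both : ∀ {w} → ¬ (w ≡ x₁ × w ≡ x₂)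
      not-both (refl , w≡) = noLoop e w≡

    load-≤-deg-u+deg-v : Joins s u v → ¬ AdjacentToUncovered u → ¬ AdjacentToUncovered v →
                         load s ≤ degree u + degree v
    load-≤-deg-u+deg-v {s} {u} {v} s-uv ¬adj-u ¬adj-v = begin
      load s
        ≤⟨ sum-mono-≤ (weight-≤-𝟙u+𝟙v charged⇒end) ⟩
      sum (λ e → 𝟙 (Incident? u e) + 𝟙 (Incident? v e))
        ≡⟨ ∑-distrib-+ (𝟙 ∘ Incident? u) (𝟙 ∘ Incident? v) ⟩
      degree u + degree v ∎
      where
      open ≤-Reasoning
      charged⇒end : Joins e x y → charge e x y ≡ s → u ≡ x ⊎ v ≡ x
      charged⇒end e-xy refl with charge-incident e-xy
      ... | inj₁ x∈s = Sum.map sym sym (incident⇒endpoint s-uv x∈s)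
      ... | inj₂ (¬cx , y∈s) with incident⇒endpoint s-uv y∈s
      ...   | inj₁ refl = contradiction (_ , _ , joins-sym e-xy , ¬cx) ¬adj-u
      ...   | inj₂ refl = contradiction (_ , _ , joins-sym e-xy , ¬cx) ¬adj-v

    module _ (tf : TriangleFree H) (cis : IsCIS (LineAdj H)) where

      partner-is-pendant : s ∈ M → Joins s u v → Joins e u z → ¬ Covered z →
                           Joins g v t → t ≡ u
      partner-is-pendant {s} {u} {v} {e} {z} {g} {t} s∈M s-uv e-uz ¬cz g-vt =
        decidable-stable (t ≟ u) λ t≢u →
          let (f , f∈star , f∈M′) = cis (star v) ((M - s) ∪ ⁅ e ⁆)
                (star-isMaximalClique tf (joins-sym s-uv) g-vt (t≢u ∘ sym))
                (maximum⇒maximal (exchange-isMaximumStable s∈M (joins⇒incident s-uv) e-uz ¬cz))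
          in star-misses-M′ f (∈⟦⟧⁻ (Incident? v) f∈star) (x∈p∪q⁻ (M - s) ⁅ e ⁆ f∈M′)
        where
        v∈s : Incident H v s
        v∈s = joins⇒incident (joins-sym s-uv)

        star-misses-M′ : ∀ f → Incident H v f → f ∈ M - s ⊎ f ∈ ⁅ e ⁆ → ⊥
        star-misses-M′ f v∈f (inj₁ f∈M-s) =
          M-stable f s (p─q⊆p M ⁅ s ⁆ f∈M-s) s∈M (x∈p-y⇒x≢y f∈M-s , v , v∈f , v∈s)
        star-misses-M′ f v∈f (inj₂ f∈⁅e⁆) rewrite x∈⁅y⁆⇒x≡y e f∈⁅e⁆
          with incident⇒endpoint e-uz v∈f
        ... | inj₁ refl = joins⇒≢ s-uv refl
        ... | inj₂ refl = ¬cz (s , s∈M , v∈s)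

      load-≤-deg-u+deg-u : s ∈ M → Joins s u v → AdjacentToUncovered u →
                           load s ≤ degree u + degree u
      load-≤-deg-u+deg-u {s} {u} {v} s∈M s-uv (e₀ , z , e₀-uz , ¬cz) = begin
        load s
          ≤⟨ sum-mono-≤ (weight-≤-𝟙u+𝟙u charged⇒u∈) ⟩
        sum (λ e → 𝟙 (Incident? u e) + 𝟙 (Incident? u e))
          ≡⟨ ∑-distrib-+ (𝟙 ∘ Incident? u) (𝟙 ∘ Incident? u) ⟩
        degree u + degree u ∎
        where
        open ≤-Reasoning
        meets-s⇒u∈ : ∀ {e w} → Incident H w e → Incident H w s → Incident H u e
        meets-s⇒u∈ {e} w∈e w∈s with incident⇒endpoint s-uv w∈s
        ... | inj₁ refl = w∈e
        ... | inj₂ refl with incident⇒joins w∈e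
        ...   | t , e-vt = subst (λ t → Incident H t e)
                                 (partner-is-pendant s∈M s-uv e₀-uz ¬cz e-vt)
                                 (joins⇒incident (joins-sym e-vt))

        charged⇒u∈ : Joins e x y → charge e x y ≡ s → Incident H u e
        charged⇒u∈ e-xy refl with charge-incident e-xy
        ... | inj₁ x∈s       = meets-s⇒u∈ (joins⇒incident e-xy) x∈s
        ... | inj₂ (_ , y∈s) = meets-s⇒u∈ (joins⇒incident (joins-sym e-xy)) y∈s

      module _ {ω : ℕ} (ω-max : ∀ S → IsClique (LineAdj H) S → ∣ S ∣ ≤ ω) where

        degree-≤ : ∀ v → degree v ≤ ω
        degree-≤ v = subst (_≤ ω) (∣⟦⟧∣ (Incident? v)) (ω-max (star v) (star-isClique v))

        degree+degree-≤ : ∀ u v → degree u + degree v ≤ ω + ω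
        degree+degree-≤ u v = +-mono-≤ (degree-≤ u) (degree-≤ v)

        load-≤-ω+ω : s ∈ M → load s ≤ ω + ω
        load-≤-ω+ω {s} s∈M with adjacentToUncovered? (end₁ s) | adjacentToUncovered? (end₂ s)
        ... | yes adj | _ = ≤-trans (load-≤-deg-u+deg-u s∈M (joins-ends s) adj)
                                    (degree+degree-≤ (end₁ s) (end₁ s))
        ... | no _ | yes adj = ≤-trans (load-≤-deg-u+deg-u s∈M (joins-sym (joins-ends s)) adj)
                                       (degree+degree-≤ (end₂ s) (end₂ s))
        ... | no ¬adj₁ | no ¬adj₂ = ≤-trans (load-≤-deg-u+deg-v (joins-ends s) ¬adj₁ ¬adj₂)
                                            (degree+degree-≤ (end₁ s) (end₂ s))

        load-≤ : ∀ s → load s ≤ 𝟙 (s ∈? M) * (ω + ω)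
        load-≤ s with s ∈? M
        ... | yes s∈M = subst (load s ≤_) (sym (+-identityʳ (ω + ω))) (load-≤-ω+ω s∈M)
        ... | no s∉M  = ≤-reflexive (trans (sum-cong-≗ unused) (sum-replicate-zero m))
          where
          uncharged : ∀ {e x y} → Joins e x y → 𝟙 (charge e x y ≟ s) ≡ 0
          uncharged {e} {x} {y} e-xy =
            n≤0⇒n≡0 (𝟙-mono (charge e x y ≟ s) (no s∉M) λ { refl → charge-∈ e-xy })

          unused : ∀ e → weight e s ≡ 0
          unused e = cong₂ _+_ (uncharged (joins-ends e)) (uncharged (joins-sym (joins-ends e)))

        m≤∣M∣*ω : m ≤ ∣ M ∣ * ω
        m≤∣M∣*ω = *-cancelʳ-≤ m (∣ M ∣ * ω) 2 (begin
          m * 2                              ≡⟨ sum-const m 2 ⟨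
          sum {m} (λ _ → 2)                  ≡⟨ sum-cong-≗ {x = λ e → sum (weight e)} weight-total ⟨
          sum (λ e → sum (weight e))         ≡⟨ ∑-comm weight ⟩
          sum load                           ≤⟨ sum-mono-≤ load-≤ ⟩
          sum (λ s → 𝟙∈M s * (ω + ω))        ≡⟨ *-distribʳ-sum (ω + ω) 𝟙∈M ⟨
          sum 𝟙∈M * (ω + ω)                  ≡⟨ cong (_* (ω + ω)) (∣p∣≡sum-𝟙-∈ M) ⟨
          ∣ M ∣ * (ω + ω)                    ≡⟨ double ∣ M ∣ ω ⟩
          ∣ M ∣ * ω * 2                      ∎)
          where
          open ≤-Reasoning

          𝟙∈M : Fin m → ℕ
          𝟙∈M s = 𝟙 (s ∈? M)

          double : ∀ a w → a * (w + w) ≡ a * w * 2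
          double = solve-∀

lemma17 : (H : Multigraph) → Connected H → TriangleFree H →
          IsCIS (LineAdj H) →
          (a w : ℕ) → IsStabilityNumber (LineAdj H) a → IsCliqueNumber (LineAdj H) w →
          Multigraph.m H ≤ a * w
lemma17 H _ tf cis a w ((M , M-stable , ∣M∣≡a) , α-max) (_ , ω-max) =
  subst (λ a → Multigraph.m H ≤ a * w) ∣M∣≡a (m≤∣M∣*ω H M-maximum tf cis ω-max)
  where
  M-maximum : IsMaximumStable {Adj = LineAdj H} M
  M-maximum = M-stable , λ T T-stable → subst (∣ T ∣ ≤_) (sym ∣M∣≡a) (α-max T T-stable)
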